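{- For $n\ge 5$, the Connected-compelling chromatic number of the cycle $C_n$ on $n$ vertices is $n-1$.
   Context: A proper coloring partitions the vertex set into nonempty independent color classes; a rainbow committee (RC) is a set consisting of exactly one vertex of each color. A proper coloring is Connected-compelling if every RC induces a connected subgraph; the Connected-compelling chromatic number is the minimum number of colors in such a coloring. -}

module Defs where

open import Data.Nat using (ℕ; zero; suc)
open import Data.Fin using (Fin; toℕ)
open import Data.Product using (Σ; _×_; _,_)
open import Data.Sum using (_⊎_)
open import Relation.Binary.PropositionalEquality using (_≡_; _≢_)
open import Relation.Binary.Construct.Closure.ReflexiveTransitive using (Star)
open import Function.Definitions using (Surjective)

Graph : ℕ → Set₁
Graph n = Fin n → Fin n → Set

CycSucc : (n : ℕ) → Fin n → Fin n → Set
CycSucc n i j = (toℕ j ≡ suc (toℕ i)) ⊎ ((suc (toℕ i) ≡ n) × (toℕ j ≡ zero))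

Cycle : (n : ℕ) → Graph n
Cycle n i j = CycSucc n i j ⊎ CycSucc n j i

-- A proper coloring with exactly k colors: a colour map to Fin k that is
-- surjective (all k colour classes nonempty) and gives adjacent vertices
-- different colours (colour classes independent).
record ProperColoring {n : ℕ} (G : Graph n) (k : ℕ) : Set where
  field
    col    : Fin n → Fin k
    onto   : Surjective _≡_ _≡_ col
    proper : ∀ i j → G i j → col i ≢ col j
open ProperColoring public

-- A rainbow committee: a choice of exactly one vertex of each colour,
-- i.e. r : Fin k → Fin n with col (r a) = a for every colour a.
RainbowCommittee : {n k : ℕ} {G : Graph n} → ProperColoring G k → Set
RainbowCommittee {n} {k} c = Σ (Fin k → Fin n) (λ r → ∀ a → col c (r a) ≡ a)

InducedConnected : {n k : ℕ} (G : Graph n) (r : Fin k → Fin n) → Set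
InducedConnected {n} {k} G r = ∀ a b → Star (λ x y → G (r x) (r y)) a b

ConnectedCompelling : {n k : ℕ} (G : Graph n) → ProperColoring G k → Set
ConnectedCompelling G c =
  ∀ (R : RainbowCommittee c) → InducedConnected G (Data.Product.proj₁ R)

CCChromaticNumberIs : {n : ℕ} (G : Graph n) (m : ℕ) → Set
CCChromaticNumberIs G m =
  Σ (ProperColoring G m) (ConnectedCompelling G)
  × (∀ k (c : ProperColoring G k) → ConnectedCompelling G c → m Data.Nat.≤ k)

{-# OPTIONS --safe #-}
-- Upper bound: give vertices 0 and 2 one colour and every other vertex a colour of its own.
-- A rainbow committee then consists of 1, 3, 4, …, n−1 and one of 0, 2, which is a path.
--
-- Lower bound: if a committee avoids two vertices x < y and contains a vertex strictly between
-- them and one outside [x, y], it is disconnected, because a walk inside the committee can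
-- cross neither x nor y.  With at most n − 2 colours, some colour class has three vertices or
-- two classes have two vertices each, and in every configuration one can choose a committee
-- split in this way.  Only for two interleaved pairs u < s < v < t is a fifth vertex needed,
-- and this is where n ≥ 5 enters.
module Submission where

open import Defs
open import Data.Nat as ℕ using (ℕ; suc; _≤_; _∸_; z≤n; s≤s; s≤s⁻¹; _≤?_)
import Data.Nat.Properties as ℕ
open import Data.Fin using (Fin; toℕ; fromℕ; fromℕ<; inject₁; punchIn; _<_)
  renaming (zero to fzero; suc to fsuc)
open import Data.Fin.Properties
  using (toℕ<n; toℕ-fromℕ; toℕ-fromℕ<; toℕ-inject₁; <-cmp; <-asym; <-trans;
         <⇒≢; ≤∧≢⇒<; pigeonhole; punchIn-injective; punchInᵢ≢i)
  renaming (_≟_ to _≟ᶠ_)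
open import Data.Fin.Induction using (<-weakInduction; >-weakInduction)
open import Data.Vec.Functional using (updateAt)
open import Data.Vec.Functional.Properties using (updateAt-updates; updateAt-minimal)
open import Data.Product using (Σ; _×_; _,_; proj₁; proj₂)
open import Data.Sum using (_⊎_; inj₁; inj₂; [_,_]; swap)
open import Data.Empty using (⊥; ⊥-elim)
open import Function using (const; _∘_)
open import Function.Definitions using (Surjective)
open import Relation.Nullary using (¬_; yes; no)
open import Relation.Binary.Definitions using (tri<; tri≈; tri>)
open import Relation.Binary.PropositionalEquality
  using (_≡_; _≢_; refl; sym; trans; cong; subst; ≢-sym)
open import Relation.Binary.Construct.Closure.ReflexiveTransitive
  using (Star; ε; _◅_; _◅◅_; reverse)

star-backward : ∀ {A : Set} {E : A → A → Set} (P : A → Set) →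
                (∀ {a b} → E a b → P b → P a) → ∀ {a b} → Star E a b → P b → P a
star-backward P step ε        = λ p → p
star-backward P step (e ◅ es) = step e ∘ star-backward P step es

star-via-hub : ∀ {A : Set} {E : A → A → Set} {h : A} →
               (∀ {a b} → E a b → E b a) → (∀ a → Star E a h) → ∀ a b → Star E a b
star-via-hub E-sym to-hub a b = to-hub a ◅◅ reverse E-sym (to-hub b)

module ColourClasses {n k : ℕ} {G : Graph n} (c : ProperColoring G k) where

  record _∈_ (v : Fin n) (R : RainbowCommittee c) : Set where
    constructor chosen
    field chosen-for-its-colour : proj₁ R (col c v) ≡ v

  _∉_ : Fin n → RainbowCommittee c → Set
  v ∉ R = ¬ v ∈ R

  ∉⇒≢ : ∀ {R : RainbowCommittee c} {x} → x ∉ R → ∀ a → proj₁ R a ≢ x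
  ∉⇒≢ {r , rc} x∉ a refl = x∉ (chosen (cong r (rc a)))

  sameColour-∉ : ∀ {R : RainbowCommittee c} {C v x} →
                 v ∈ R → col c v ≡ C → col c x ≡ C → x ≢ v → x ∉ R
  sameColour-∉ {r , _} (chosen v∈) cv cx x≢v (chosen x∈) =
    x≢v (trans (sym x∈) (trans (cong r (trans cx (sym cv))) v∈))

  colour-≢⇒≢ : ∀ {X Y x y} → col c x ≡ X → col c y ≡ Y → X ≢ Y → x ≢ y
  colour-≢⇒≢ cx cy X≢Y refl = X≢Y (trans (sym cx) cy)

  someCommittee : RainbowCommittee c
  someCommittee = (λ a → proj₁ (onto c a)) , (λ a → proj₂ (onto c a) refl)

  insert : RainbowCommittee c → Fin n → RainbowCommittee c
  insert (r , rc) v = updateAt r (col c v) (const v) , coloured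
    where
      coloured : ∀ a → col c (updateAt r (col c v) (const v) a) ≡ a
      coloured a with a ≟ᶠ col c v
      ... | yes refl = cong (col c) (updateAt-updates (col c v) r)
      ... | no a≢v   = trans (cong (col c) (updateAt-minimal a (col c v) r a≢v)) (rc a)

  ∈-insert : ∀ R v → v ∈ insert R v
  ∈-insert (r , _) v = chosen (updateAt-updates (col c v) r)

  ∈-insert-other : ∀ {R u} v → u ∈ R → col c u ≢ col c v → u ∈ insert R v
  ∈-insert-other {r , _} {u} v (chosen u∈) u≢v =
    chosen (trans (updateAt-minimal (col c u) (col c v) r u≢v) u∈)

  pair : Fin n → Fin n → RainbowCommittee c
  pair p q = insert (insert someCommittee q) p

  ∈-pairˡ : ∀ p q → p ∈ pair p q
  ∈-pairˡ p q = ∈-insert _ p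

  ∈-pairʳ : ∀ {X Y p q} → col c p ≡ X → col c q ≡ Y → Y ≢ X → q ∈ pair p q
  ∈-pairʳ {p = p} {q} cp cq Y≢X =
    ∈-insert-other p (∈-insert _ q) (λ e → Y≢X (trans (sym cq) (trans e cp)))

  triple : Fin n → Fin n → Fin n → RainbowCommittee c
  triple p q s = insert (pair q s) p

  ∈-tripleˡ : ∀ p q s → p ∈ triple p q s
  ∈-tripleˡ p q s = ∈-insert _ p

  ∈-tripleᵐ : ∀ {X Y p q} s → col c p ≡ X → col c q ≡ Y → Y ≢ X → q ∈ triple p q s
  ∈-tripleᵐ {p = p} {q} s cp cq Y≢X =
    ∈-insert-other p (∈-pairˡ q s) (λ e → Y≢X (trans (sym cq) (trans e cp)))

  ∈-tripleʳ : ∀ {X Y Z p q s} → col c p ≡ X → col c q ≡ Y → col c s ≡ Z →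
              Z ≢ X → Z ≢ Y → s ∈ triple p q s
  ∈-tripleʳ {p = p} cp cq cs Z≢X Z≢Y =
    ∈-insert-other p (∈-pairʳ cq cs Z≢Y) (λ e → Z≢X (trans (sym cs) (trans e cp)))

  record ColourPair (C : Fin k) : Set where
    constructor colourPair
    field
      lo hi  : Fin n
      lo<hi  : lo < hi
      col-lo : col c lo ≡ C
      col-hi : col c hi ≡ C

  open ColourPair public

  orderedPair : ∀ {C a b} → a ≢ b → col c a ≡ C → col c b ≡ C → ColourPair C
  orderedPair {a = a} {b} a≢b ca cb with <-cmp a b
  ... | tri< a<b _ _ = colourPair a b a<b ca cb
  ... | tri≈ _ a≡b _ = ⊥-elim (a≢b a≡b)
  ... | tri> _ _ b<a = colourPair b a b<a cb ca

Inside : ∀ {n} → Fin n → Fin n → Fin n → Set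
Inside x y v = x < v × v < y

Outside : ∀ {n} → Fin n → Fin n → Fin n → Set
Outside x y v = v < x ⊎ y < v

outside⇒¬inside : ∀ {n} {x y v : Fin n} → Outside x y v → ¬ Inside x y v
outside⇒¬inside (inj₁ v<x) (x<v , _)   = <-asym v<x x<v
outside⇒¬inside (inj₂ y<v) (_   , v<y) = <-asym y<v v<y

inside-adjacent : ∀ {n} {x y a b : Fin n} →
                  Cycle n a b → a ≢ x → a ≢ y → Inside x y b → Inside x y a
inside-adjacent {x = x} {y} {a} (inj₁ (inj₁ b≡1+a)) a≢x _ (x<b , b<y) =
  ≤∧≢⇒< (s≤s⁻¹ (subst (suc (toℕ x) ℕ.≤_) b≡1+a x<b)) (a≢x ∘ sym) ,
  <-trans {i = a} (subst (toℕ a ℕ.<_) (sym b≡1+a) (ℕ.n<1+n _)) b<y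
inside-adjacent {x = x} (inj₁ (inj₂ (_ , b≡0))) _ _ (x<b , _) =
  ⊥-elim (ℕ.n≮0 (subst (toℕ x ℕ.<_) b≡0 x<b))
inside-adjacent {y = y} {b = b} (inj₂ (inj₁ a≡1+b)) _ a≢y (x<b , b<y) =
  <-trans x<b (subst (toℕ b ℕ.<_) (sym a≡1+b) (ℕ.n<1+n _)) ,
  ≤∧≢⇒< (subst (ℕ._≤ toℕ y) (sym a≡1+b) b<y) a≢y
inside-adjacent {y = y} (inj₂ (inj₂ (1+b≡n , _))) _ _ (_ , b<y) =
  ⊥-elim (ℕ.<⇒≱ b<y (s≤s⁻¹ (subst (toℕ y ℕ.<_) (sym 1+b≡n) (toℕ<n y))))

-- The arcs cut out of the cycle by u < s < v < t.  Positions are natural numbers so that, at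
-- toℕ of vertices, the constructor arguments are literally Inside / Outside facts.
data Arc (u s v t e : ℕ) : Set where
  arc-tu : e ℕ.< u ⊎ t ℕ.< e → Arc u s v t e
  arc-us : u ℕ.< e → e ℕ.< s → Arc u s v t e
  arc-sv : s ℕ.< e → e ℕ.< v → Arc u s v t e
  arc-vt : v ℕ.< e → e ℕ.< t → Arc u s v t e

arc-vertex : ∀ {u s v t n} → u ℕ.< s → s ℕ.< v → v ℕ.< t → t ℕ.< n → 5 ≤ n →
             Σ ℕ λ e → e ℕ.< n × Arc u s v t e
arc-vertex {u} u<s s<v v<t t<n 5≤n with ℕ.m≤n⇒m<n∨m≡n u<s
... | inj₁ 1+u<s =
  suc u , ℕ.<-trans 1+u<s (ℕ.<-trans s<v (ℕ.<-trans v<t t<n)) , arc-us (ℕ.n<1+n u) 1+u<s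
... | inj₂ refl with ℕ.m≤n⇒m<n∨m≡n s<v
... | inj₁ 2+u<v = suc (suc u) , ℕ.<-trans 2+u<v (ℕ.<-trans v<t t<n) , arc-sv (ℕ.n<1+n _) 2+u<v
... | inj₂ refl with ℕ.m≤n⇒m<n∨m≡n v<t
... | inj₁ 3+u<t = suc (suc (suc u)) , ℕ.<-trans 3+u<t t<n , arc-vt (ℕ.n<1+n _) 3+u<t
... | inj₂ refl with ℕ.m≤n⇒m<n∨m≡n t<n
... | inj₁ 4+u<n = suc (suc (suc (suc u))) , 4+u<n , arc-tu (inj₂ (ℕ.n<1+n _))
... | inj₂ refl = 0 , ℕ.z<s , arc-tu (inj₁ (s≤s⁻¹ (s≤s⁻¹ (s≤s⁻¹ (s≤s⁻¹ 5≤n)))))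

arc-avoids : ∀ {u s v t e} → u ℕ.< s → s ℕ.< v → v ℕ.< t → Arc u s v t e →
             e ≢ u × e ≢ s × e ≢ v × e ≢ t
arc-avoids u<s s<v v<t (arc-tu (inj₁ e<u)) =
  let e<s = ℕ.<-trans e<u u<s ; e<v = ℕ.<-trans e<s s<v in
  ℕ.<⇒≢ e<u , ℕ.<⇒≢ e<s , ℕ.<⇒≢ e<v , ℕ.<⇒≢ (ℕ.<-trans e<v v<t)
arc-avoids u<s s<v v<t (arc-tu (inj₂ t<e)) =
  let v<e = ℕ.<-trans v<t t<e ; s<e = ℕ.<-trans s<v v<e in
  ℕ.>⇒≢ (ℕ.<-trans u<s s<e) , ℕ.>⇒≢ s<e , ℕ.>⇒≢ v<e , ℕ.>⇒≢ t<e
arc-avoids u<s s<v v<t (arc-us u<e e<s) =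
  let e<v = ℕ.<-trans e<s s<v in
  ℕ.>⇒≢ u<e , ℕ.<⇒≢ e<s , ℕ.<⇒≢ e<v , ℕ.<⇒≢ (ℕ.<-trans e<v v<t)
arc-avoids u<s s<v v<t (arc-sv s<e e<v) =
  ℕ.>⇒≢ (ℕ.<-trans u<s s<e) , ℕ.>⇒≢ s<e , ℕ.<⇒≢ e<v , ℕ.<⇒≢ (ℕ.<-trans e<v v<t)
arc-avoids u<s s<v v<t (arc-vt v<e e<t) =
  let s<e = ℕ.<-trans s<v v<e in
  ℕ.>⇒≢ (ℕ.<-trans u<s s<e) , ℕ.>⇒≢ s<e , ℕ.>⇒≢ v<e , ℕ.<⇒≢ e<t

module ConnectedCompellingCycle {n k : ℕ} (c : ProperColoring (Cycle n) k)
                                (cc : ConnectedCompelling (Cycle n) c) where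
  open ColourClasses c

  committee-not-split : ∀ (R : RainbowCommittee c) {x y z w} →
                        Inside x y z → Outside x y w → z ∈ R → w ∈ R → x ∉ R → y ∉ R → ⊥
  committee-not-split R@(r , _) {x} {y} {z} {w} z-in w-out (chosen z∈) (chosen w∈) x∉ y∉ =
    outside⇒¬inside w-out (subst (Inside x y) w∈ w-in)
    where
      w-in : Inside x y (r (col c w))
      w-in = star-backward (Inside x y ∘ r)
               (λ e → inside-adjacent e (∉⇒≢ x∉ _) (∉⇒≢ y∉ _))
               (cc R (col c w) (col c z)) (subst (Inside x y) (sym z∈) z-in)

  no-three-in-order : ∀ {C a b d} → col c a ≡ C → col c b ≡ C → col c d ≡ C →
                      a < b → b < d → ⊥
  no-three-in-order {C} {a} {b} {d} ca cb cd a<b b<d =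
    committee-not-split (pair a z) (b<z , z<d) (inj₁ a<b) (∈-pairʳ ca refl z≢C) (∈-pairˡ a z)
      (sameColour-∉ (∈-pairˡ a z) ca cb (<⇒≢ a<b ∘ sym))
      (sameColour-∉ (∈-pairˡ a z) ca cd (<⇒≢ (<-trans a<b b<d) ∘ sym))
    where
      1+b<n : suc (toℕ b) ℕ.< n
      1+b<n = ℕ.≤-<-trans b<d (toℕ<n d)
      z : Fin n
      z = fromℕ< 1+b<n
      z≡1+b : toℕ z ≡ suc (toℕ b)
      z≡1+b = toℕ-fromℕ< 1+b<n
      z≢C : col c z ≢ C
      z≢C cz = proper c b z (inj₁ (inj₁ z≡1+b)) (trans cb (sym cz))
      b<z : b < z
      b<z = subst (toℕ b ℕ.<_) (sym z≡1+b) (ℕ.n<1+n _)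
      z<d : z < d
      z<d = ≤∧≢⇒< (subst (ℕ._≤ toℕ d) (sym z≡1+b) b<d) (colour-≢⇒≢ refl cd z≢C)

  no-third : ∀ {C d} (P : ColourPair C) → col c d ≡ C → d ≢ lo P → d ≢ hi P → ⊥
  no-third {d = d} (colourPair lo hi lo<hi clo chi) cd d≢lo d≢hi with <-cmp d lo
  ... | tri< d<lo _ _ = no-three-in-order cd clo chi d<lo lo<hi
  ... | tri≈ _ d≡lo _ = d≢lo d≡lo
  ... | tri> _ _ lo<d with <-cmp d hi
  ...   | tri< d<hi _ _ = no-three-in-order clo cd chi lo<d d<hi
  ...   | tri≈ _ d≡hi _ = d≢hi d≡hi
  ...   | tri> _ _ hi<d = no-three-in-order clo chi cd lo<hi hi<d

  no-third-colour-in-arc : ∀ {A B e} (P : ColourPair A) (Q : ColourPair B) → A ≢ B →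
    lo P < lo Q → lo Q < hi P → hi P < hi Q → col c e ≢ A → col c e ≢ B →
    Arc (toℕ (lo P)) (toℕ (lo Q)) (toℕ (hi P)) (toℕ (hi Q)) (toℕ e) → ⊥
  no-third-colour-in-arc {e = e} (colourPair u v u<v cu cv) (colourPair s t s<t cs ct)
                         A≢B u<s s<v v<t e≢A e≢B = λ where
    (arc-tu e-out) →
      committee-not-split (triple e s v) (u<s , s<t) e-out
        (∈-tripleᵐ v refl cs (≢-sym e≢B)) (∈-tripleˡ e s v)
        (sameColour-∉ (∈-tripleʳ refl cs cv (≢-sym e≢A) A≢B) cv cu (<⇒≢ u<v))
        (sameColour-∉ (∈-tripleᵐ v refl cs (≢-sym e≢B)) cs ct (<⇒≢ s<t ∘ sym))
    (arc-us u<e e<s) →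
      committee-not-split (triple e v t) (u<e , e<s) (inj₂ s<v)
        (∈-tripleˡ e v t) (∈-tripleᵐ t refl cv (≢-sym e≢A))
        (sameColour-∉ (∈-tripleᵐ t refl cv (≢-sym e≢A)) cv cu (<⇒≢ u<v))
        (sameColour-∉ (∈-tripleʳ refl cv ct (≢-sym e≢B) (≢-sym A≢B)) ct cs (<⇒≢ s<t))
    (arc-sv s<e e<v) →
      committee-not-split (triple e u t) (s<e , e<v) (inj₁ u<s)
        (∈-tripleˡ e u t) (∈-tripleᵐ t refl cu (≢-sym e≢A))
        (sameColour-∉ (∈-tripleʳ refl cu ct (≢-sym e≢B) (≢-sym A≢B)) ct cs (<⇒≢ s<t))
        (sameColour-∉ (∈-tripleᵐ t refl cu (≢-sym e≢A)) cu cv (<⇒≢ u<v ∘ sym))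
    (arc-vt v<e e<t) →
      committee-not-split (triple e u s) (v<e , e<t) (inj₁ u<v)
        (∈-tripleˡ e u s) (∈-tripleᵐ s refl cu (≢-sym e≢A))
        (sameColour-∉ (∈-tripleᵐ s refl cu (≢-sym e≢A)) cu cv (<⇒≢ u<v ∘ sym))
        (sameColour-∉ (∈-tripleʳ refl cu cs (≢-sym e≢B) (≢-sym A≢B)) cs ct (<⇒≢ s<t ∘ sym))

  no-vertex-in-arc : ∀ {A B} (P : ColourPair A) (Q : ColourPair B) → A ≢ B →
    lo P < lo Q → lo Q < hi P → hi P < hi Q →
    ∀ e → Arc (toℕ (lo P)) (toℕ (lo Q)) (toℕ (hi P)) (toℕ (hi Q)) (toℕ e) → ⊥
  no-vertex-in-arc {A} {B} P Q A≢B u<s s<v v<t e arc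
    with arc-avoids u<s s<v v<t arc | col c e ≟ᶠ A | col c e ≟ᶠ B
  ... | e≢u , _ , e≢v , _ | yes e∈A | _ = no-third P e∈A (e≢u ∘ cong toℕ) (e≢v ∘ cong toℕ)
  ... | _ , e≢s , _ , e≢t | no _ | yes e∈B = no-third Q e∈B (e≢s ∘ cong toℕ) (e≢t ∘ cong toℕ)
  ... | _ | no e≢A | no e≢B = no-third-colour-in-arc P Q A≢B u<s s<v v<t e≢A e≢B arc

  no-interleaved : ∀ {A B} → 5 ≤ n → (P : ColourPair A) (Q : ColourPair B) → A ≢ B →
                   lo P < lo Q → lo Q < hi P → hi P < hi Q → ⊥
  no-interleaved 5≤n P Q A≢B u<s s<v v<t
    with arc-vertex u<s s<v v<t (toℕ<n (hi Q)) 5≤n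
  ... | e , e<n , arc =
    no-vertex-in-arc P Q A≢B u<s s<v v<t (fromℕ< e<n) (subst (Arc _ _ _ _) (sym (toℕ-fromℕ< e<n)) arc)

  no-two-pairs-ordered : ∀ {A B} → 5 ≤ n → (P : ColourPair A) (Q : ColourPair B) → A ≢ B →
                         lo P < lo Q → ⊥
  no-two-pairs-ordered 5≤n P@(colourPair u v u<v cu cv) Q@(colourPair s t s<t cs ct) A≢B u<s
    with <-cmp v s
  ... | tri< v<s _ _ =
    committee-not-split (pair s u) (v<s , s<t) (inj₁ u<v) (∈-pairˡ s u) (∈-pairʳ cs cu A≢B)
      (sameColour-∉ (∈-pairʳ cs cu A≢B) cu cv (<⇒≢ u<v ∘ sym))
      (sameColour-∉ (∈-pairˡ s u) cs ct (<⇒≢ s<t ∘ sym))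
  ... | tri≈ _ v≡s _ = colour-≢⇒≢ cv cs A≢B v≡s
  ... | tri> _ _ s<v with <-cmp v t
  ...   | tri< v<t _ _ = no-interleaved 5≤n P Q A≢B u<s s<v v<t
  ...   | tri≈ _ v≡t _ = colour-≢⇒≢ cv ct A≢B v≡t
  ...   | tri> _ _ t<v =
    committee-not-split (pair t u) (s<t , t<v) (inj₁ u<s) (∈-pairˡ t u) (∈-pairʳ ct cu A≢B)
      (sameColour-∉ (∈-pairˡ t u) ct cs (<⇒≢ s<t))
      (sameColour-∉ (∈-pairʳ ct cu A≢B) cu cv (<⇒≢ u<v ∘ sym))

  no-two-pairs : ∀ {A B} → 5 ≤ n → ColourPair A → ColourPair B → A ≢ B → ⊥
  no-two-pairs 5≤n P Q A≢B with <-cmp (lo P) (lo Q)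
  ... | tri< p<q _ _ = no-two-pairs-ordered 5≤n P Q A≢B p<q
  ... | tri≈ _ p≡q _ = colour-≢⇒≢ (col-lo P) (col-lo Q) A≢B p≡q
  ... | tri> _ _ q<p = no-two-pairs-ordered 5≤n Q P (A≢B ∘ sym) q<p

  no-second-repeat : ∀ {A a b} → 5 ≤ n → (P : ColourPair A) →
                     a ≢ b → col c a ≡ col c b → a ≢ hi P → b ≢ hi P → ⊥
  no-second-repeat {A} {a} {b} 5≤n P a≢b ca≡cb a≢hi b≢hi with col c a ≟ᶠ A | a ≟ᶠ lo P
  ... | yes a∈A | yes a≡lo =
    no-third P (trans (sym ca≡cb) a∈A) (λ b≡lo → a≢b (trans a≡lo (sym b≡lo))) b≢hi
  ... | yes a∈A | no a≢lo = no-third P a∈A a≢lo a≢hi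
  ... | no a∉A  | _       = no-two-pairs 5≤n P (orderedPair a≢b refl (sym ca≡cb)) (a∉A ∘ sym)

cc-colours-≥ : ∀ {n k} (c : ProperColoring (Cycle (suc n)) k) →
               ConnectedCompelling (Cycle (suc n)) c → 5 ≤ suc n → n ≤ k
cc-colours-≥ {n} {k} c cc 5≤n with n ≤? k
... | yes n≤k = n≤k
... | no n≰k
  with pigeonhole (ℕ.m<n⇒m<1+n (ℕ.≰⇒> n≰k)) (col c)
... | i , j , i<j , ci≡cj
  with pigeonhole (ℕ.≰⇒> n≰k) (col c ∘ punchIn j)
... | a , b , a<b , ca≡cb =
  ⊥-elim (no-second-repeat 5≤n (colourPair i j i<j refl (sym ci≡cj))
            (<⇒≢ a<b ∘ punchIn-injective j a b) ca≡cb (punchInᵢ≢i j a) (punchInᵢ≢i j b))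
  where
    open ColourClasses c
    open ConnectedCompellingCycle c cc

cycSucc-irreflexive : ∀ {n} {i : Fin (2 ℕ.+ n)} → ¬ CycSucc (2 ℕ.+ n) i i
cycSucc-irreflexive (inj₁ i≡1+i) = ℕ.1+n≢n (sym i≡1+i)
cycSucc-irreflexive (inj₂ (1+i≡n , i≡0)) =
  ℕ.0≢1+n (ℕ.suc-injective (trans (cong suc (sym i≡0)) 1+i≡n))

cycle-irreflexive : ∀ {n} {i : Fin (2 ℕ.+ n)} → ¬ Cycle (2 ℕ.+ n) i i
cycle-irreflexive = [ cycSucc-irreflexive , cycSucc-irreflexive ]

cycSucc-inject₁ : ∀ {n} (i : Fin n) → CycSucc (suc n) (inject₁ i) (fsuc i)
cycSucc-inject₁ i = inj₁ (cong suc (sym (toℕ-inject₁ i)))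

cycSucc-fromℕ : ∀ n → CycSucc (suc n) (fromℕ n) fzero
cycSucc-fromℕ n = inj₂ (cong suc (toℕ-fromℕ n) , refl)

module MergedColouring (m : ℕ) where

  colouring : Fin (5 ℕ.+ m) → Fin (4 ℕ.+ m)
  colouring fzero    = fsuc fzero
  colouring (fsuc v) = v

  colouring-onto : Surjective _≡_ _≡_ colouring
  colouring-onto a = fsuc a , λ { refl → refl }

  colour-class : ∀ {v a} → colouring v ≡ a → a ≢ fsuc fzero → v ≡ fsuc a
  colour-class {fzero}  refl a≢1 = ⊥-elim (a≢1 refl)
  colour-class {fsuc v} refl _   = refl

  colour-class₁ : ∀ {v} → colouring v ≡ fsuc fzero → v ≡ fzero ⊎ v ≡ fsuc (fsuc fzero)
  colour-class₁ {fzero}  _    = inj₁ refl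
  colour-class₁ {fsuc v} refl = inj₂ refl

  ¬adjacent-0-2 : ¬ Cycle (5 ℕ.+ m) fzero (fsuc (fsuc fzero))
  ¬adjacent-0-2 (inj₁ (inj₁ ()))
  ¬adjacent-0-2 (inj₁ (inj₂ (() , _)))
  ¬adjacent-0-2 (inj₂ (inj₁ ()))
  ¬adjacent-0-2 (inj₂ (inj₂ (() , _)))

  colouring-proper : ∀ i j → Cycle (5 ℕ.+ m) i j → colouring i ≢ colouring j
  colouring-proper fzero    fzero    adj _    = cycle-irreflexive adj
  colouring-proper fzero    (fsuc j) adj refl = ¬adjacent-0-2 adj
  colouring-proper (fsuc i) fzero    adj refl = ¬adjacent-0-2 (swap adj)
  colouring-proper (fsuc i) (fsuc j) adj refl = cycle-irreflexive adj

  properColouring : ProperColoring (Cycle (5 ℕ.+ m)) (4 ℕ.+ m)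
  properColouring = record { col = colouring ; onto = colouring-onto ; proper = colouring-proper }

  connectedCompelling : ConnectedCompelling (Cycle (5 ℕ.+ m)) properColouring
  connectedCompelling (r , rc) = star-via-hub swap to-hub
    where
      E : Fin (4 ℕ.+ m) → Fin (4 ℕ.+ m) → Set
      E a b = Cycle (5 ℕ.+ m) (r a) (r b)

      edge : ∀ {a b u v} → r a ≡ u → r b ≡ v → Cycle (5 ℕ.+ m) u v → E a b
      edge refl refl uv = uv

      member : ∀ a → a ≢ fsuc fzero → r a ≡ fsuc a
      member a a≢1 = colour-class (rc a) a≢1

      step : ∀ (i : Fin (suc m)) → E (fsuc (fsuc (inject₁ i))) (fsuc (fsuc (fsuc i)))
      step i = edge (member _ λ ()) (member _ λ ()) (inj₁ (cycSucc-inject₁ (fsuc (fsuc (fsuc i)))))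

      down : ∀ j → Star E (fsuc (fsuc j)) (fsuc (fsuc fzero))
      down = <-weakInduction (λ j → Star E (fsuc (fsuc j)) (fsuc (fsuc fzero)))
               ε (λ i p → swap (step i) ◅ p)

      up : ∀ j → Star E (fsuc (fsuc j)) (fsuc (fsuc (fromℕ (suc m))))
      up = >-weakInduction (λ j → Star E (fsuc (fsuc j)) (fsuc (fsuc (fromℕ (suc m)))))
             ε (λ i p → step i ◅ p)

      to-hub : ∀ a → Star E a (fsuc fzero)
      to-hub a with colour-class₁ {r (fsuc fzero)} (rc (fsuc fzero))
      to-hub fzero           | inj₁ hub≡0 = edge (member _ λ ()) hub≡0 (inj₂ (inj₁ refl)) ◅ ε
      to-hub fzero           | inj₂ hub≡2 = edge (member _ λ ()) hub≡2 (inj₁ (inj₁ refl)) ◅ ε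
      to-hub (fsuc fzero)    | _          = ε
      to-hub (fsuc (fsuc j)) | inj₁ hub≡0 =
        up j ◅◅ (edge (member _ λ ()) hub≡0 (inj₁ (cycSucc-fromℕ (4 ℕ.+ m))) ◅ ε)
      to-hub (fsuc (fsuc j)) | inj₂ hub≡2 =
        down j ◅◅ (edge (member _ λ ()) hub≡2 (inj₂ (inj₁ refl)) ◅ ε)

mainTheorem15 : (n : ℕ) → 5 ≤ n → CCChromaticNumberIs (Cycle n) (n ∸ 1)
mainTheorem15 _ 5≤n@(s≤s (s≤s (s≤s (s≤s (s≤s (z≤n {m})))))) =
  (properColouring , connectedCompelling) , λ k c cc → cc-colours-≥ c cc 5≤n
  where open MergedColouring m
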